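{- Let $X$ be an $L_X$-step and $Y$ an $L_Y$-step subshift of finite type. Then: (1) if $|\mathcal{L}_{L_X}(X)|<|\mathcal{L}_{L_Y}(Y)|$, then $X$ and $Y$ are directly conjugate if and only if there exists an integer $K>0$ such that $X^{[L_X+K]}$ is similar to $Y^{[L_Y]}$; (2) if $|\mathcal{L}_{L_X}(X)|>|\mathcal{L}_{L_Y}(Y)|$, then $X$ and $Y$ are directly conjugate if and only if there exists an integer $K>0$ such that $X^{[L_X]}$ is similar to $Y^{[L_Y+K]}$; (3) if $|\mathcal{L}_{L_X}(X)|=|\mathcal{L}_{L_Y}(Y)|$, then $X$ and $Y$ are directly conjugate if and only if $X^{[L_X]}$ is similar to $Y^{[L_Y]}$.
   Context: A subshift is a closed, shift-invariant subset of $\mathcal{A}^{\mathbb{Z}}$ (shift $\sigma(u)_n=u_{n+1}$). It is an $L$-step subshift of finite type if it is the set of all bi-infinite words having no subword in some finite set $F\subseteq\mathcal{A}^{L+1}$. $\mathcal{L}_n(Z)$ is the set of subwords of length $n$ of words of $Z$. The $N$-block presentation $Z^{[N]}$ replaces each word $u$ by the word whose $i$-th letter is the block $[u_iu_{i+1}\dots u_{i+N-1}]$. A projection is a map between alphabets extended letter by letter; $Z\succcurlyeq W$ means $\varphi(Z)=W$ for some projection $\varphi$; $Z$ and $W$ are similar if $Z\succcurlyeq W$ and $W\succcurlyeq Z$. Two SFTs $X,Y$ are directly conjugate if there exist positive integers $M,N$ such that $X^{[M]}$ and $Y^{[N]}$ are similar. -}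

module Defs where

open import Data.Nat using (ℕ; suc)
open import Data.Fin using (Fin; toℕ)
open import Data.Integer using (ℤ; +_; _+_)
open import Data.Vec using (Vec; tabulate)
open import Data.List using (List; length)
open import Data.List.Membership.Propositional using (_∈_)
open import Data.List.Relation.Unary.Unique.Propositional using (Unique)
open import Data.Product using (Σ; ∃; _×_; _,_)
open import Relation.Binary.PropositionalEquality using (_≡_)
open import Relation.Nullary using (¬_)
open import Function.Bundles using (_⇔_)

Word : Set → Set
Word A = ℤ → A

Subset : Set → Set₁
Subset A = Word A → Set

block : {A : Set} → Word A → ℤ → (n : ℕ) → Vec A n
block u i n = tabulate (λ j → u (i + + toℕ j))

-- The L-step subshift of finite type over the finite alphabet Fin a defined by
-- the finite set F ⊆ A^(L+1) of forbidden words.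
SFT : {a : ℕ} (L : ℕ) → List (Vec (Fin a) (suc L)) → Subset (Fin a)
SFT L F u = ∀ i → ¬ (block u i (suc L) ∈ F)

Lang : {A : Set} → Subset A → (n : ℕ) → Vec A n → Set
Lang Z n w = ∃ λ u → Z u × ∃ λ i → block u i n ≡ w

HasCard : {B : Set} → (B → Set) → ℕ → Set
HasCard {B} P k = Σ (List B) λ ws → Unique ws × length ws ≡ k × (∀ w → (w ∈ ws ⇔ P w))

_^[_] : {A : Set} → Subset A → (N : ℕ) → Subset (Vec A N)
(Z ^[ N ]) v = ∃ λ u → Z u × (∀ i → v i ≡ block u i N)

-- Z ≽ W: φ(Z) = W for a letter-to-letter projection φ (image equality,
-- with words compared pointwise).
_≽_ : {A B : Set} → Subset A → Subset B → Set
_≽_ {A} {B} Z W = Σ (A → B) λ φ →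
  (∀ u → Z u → W (λ i → φ (u i))) ×
  (∀ w → W w → ∃ λ u → Z u × (∀ i → φ (u i) ≡ w i))

Similar : {A B : Set} → Subset A → Subset B → Set
Similar Z W = (Z ≽ W) × (W ≽ Z)

DirectlyConjugate : {A B : Set} → Subset A → Subset B → Set
DirectlyConjugate X Y = ∃ λ M → ∃ λ N → Similar (X ^[ suc M ]) (Y ^[ suc N ])

-- A similarity X^[m] ~ Y^[n] of block presentations lifts to X^[m+1] ~ Y^[n+1] for any
-- subshifts.  For SFTs it also descends to X^[m-1] ~ Y^[n-1] as long as m > L_X and n > L_Y:
-- recode an (m-1)-block w of X by prepending a letter c that can precede it and dropping the
-- first letter of the image.  The prepended block occurs in X because an L_X-step SFT allows
-- splicing two of its points that overlap in L_X - 1 letters, and this makes the result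
-- independent of c.  Lifting a direct conjugacy and then descending as far as possible leaves
-- X^[L_X + K] ~ Y^[L_Y] or X^[L_X] ~ Y^[L_Y + K].  A projection X^[p] ≽ Y^[q] maps L_p(X)
-- onto L_q(Y), so only the side with the smaller language can keep the longer blocks; when
-- the languages have equal size the truncated projection is a bijection between them, and its
-- inverse brings K down to 0.

module Submission where

open import Defs
open import Data.Bool using (if_then_else_)
open import Data.Fin using (Fin; toℕ; fromℕ<)
import Data.Fin.Properties as FP
open import Data.Integer as ℤ using (ℤ; +_; +≤+; +<+; ∣_∣) renaming (suc to sucℤ; pred to predℤ)
import Data.Integer.Properties as ℤP
open import Data.Integer.Tactic.RingSolver using () renaming (solve-∀ to ℤ-solve-∀)
open import Data.List using (List; []; _∷_; length; map)
open import Data.List.Membership.Propositional using (_∈_; find; lose)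
open import Data.List.Membership.Propositional.Properties using (∈-map⁺)
import Data.List.Membership.DecPropositional as DecMembership
open import Data.List.Properties using (length-map; length-removeAt′)
open import Data.List.Relation.Binary.Subset.Propositional using (_⊆_)
open import Data.List.Relation.Unary.All as All using ()
open import Data.List.Relation.Unary.AllPairs using ([]; _∷_)
open import Data.List.Relation.Unary.Any using (here; there; any?; index; _─_)
open import Data.List.Relation.Unary.Unique.Propositional using (Unique)
open import Data.Nat using (ℕ; zero; suc; _+_; _≤_; _<_; _>_; z≤n; s≤s)
import Data.Nat.Properties as ℕP
open import Data.Nat.Tactic.RingSolver using () renaming (solve-∀ to ℕ-solve-∀)
open import Data.Product using (∃; _×_; _,_; proj₁; proj₂; map₂)
open import Data.Sum using (_⊎_; inj₁; inj₂)
open import Data.Vec using (Vec; _∷_; head; tail; init; take; _++_; replicate; lookup)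
import Data.Vec.Properties as VP
open import Function.Base using (_∘_)
open import Function.Bundles using (_⇔_; mk⇔; Equivalence)
open import Relation.Binary.Definitions using (DecidableEquality; tri<; tri≈; tri>)
open import Relation.Binary.PropositionalEquality
open import Relation.Nullary using (¬_; Dec; yes; no; does; contradiction)
open import Relation.Nullary.Decidable as Dec using (_×-dec_; ¬?)
open import Relation.Unary using (Decidable)

private variable
  A B : Set
  Z : Subset A
  W : Subset B
  e k s t : ℤ
  a m n p q K : ℕ

+-suc-index : ∀ i n → i ℤ.+ + suc n ≡ sucℤ i ℤ.+ + n
+-suc-index i n = trans (cong (ℤ._+_ i) (ℤP.pos-+ 1 n)) (shift i (+ n))
  where
  shift : ∀ i x → i ℤ.+ (+ 1 ℤ.+ x) ≡ (+ 1 ℤ.+ i) ℤ.+ x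
  shift = ℤ-solve-∀

i<suc[i] : ∀ i → i ℤ.< sucℤ i
i<suc[i] i = ℤP.suc[i]≤j⇒i<j (ℤP.≤-refl {sucℤ i})

block-suc : (u : Word A) (i : ℤ) (n : ℕ) → block u i (suc n) ≡ u i ∷ block u (sucℤ i) n
block-suc u i n =
  cong₂ _∷_ (cong u (ℤP.+-identityʳ i)) (VP.tabulate-cong (λ j → cong u (+-suc-index i (toℕ j))))

block-take : (u : Word A) (i : ℤ) (n K : ℕ) → take n (block u i (n + K)) ≡ block u i n
block-take u i zero    K = refl
block-take u i (suc n) K = begin
  take (suc n) (block u i (suc n + K))     ≡⟨ cong (take (suc n)) (block-suc u i (n + K)) ⟩
  u i ∷ take n (block u (sucℤ i) (n + K))  ≡⟨ cong (u i ∷_) (block-take u (sucℤ i) n K) ⟩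
  u i ∷ block u (sucℤ i) n                 ≡⟨ block-suc u i n ⟨
  block u i (suc n)                        ∎
  where open ≡-Reasoning

block-init : (u : Word A) (i : ℤ) (n : ℕ) → init (block u i (suc n)) ≡ block u i n
block-init u i zero    = refl
block-init u i (suc n) = begin
  init (block u i (suc (suc n)))           ≡⟨ cong init (block-suc u i (suc n)) ⟩
  u i ∷ init (block u (sucℤ i) (suc n))    ≡⟨ cong (u i ∷_) (block-init u (sucℤ i) n) ⟩
  u i ∷ block u (sucℤ i) n                 ≡⟨ block-suc u i n ⟨
  block u i (suc n)                        ∎
  where open ≡-Reasoning

block-tail : (u : Word A) (i : ℤ) (n : ℕ) → tail (block u i (suc n)) ≡ block u (sucℤ i) n
block-tail u i n = cong tail (block-suc u i n)

block-shift : (u : Word A) (d t : ℤ) (n : ℕ) → block (λ k → u (k ℤ.+ d)) t n ≡ block u (t ℤ.+ d) n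
block-shift u d t n = VP.tabulate-cong (λ j → cong u (swap t (+ toℕ j) d))
  where
  swap : ∀ t x d → t ℤ.+ x ℤ.+ d ≡ t ℤ.+ d ℤ.+ x
  swap = ℤ-solve-∀

block-cong : {u v : Word A} (s : ℤ) (n : ℕ) →
             (∀ k → s ℤ.≤ k → k ℤ.< s ℤ.+ + n → u k ≡ v k) → block u s n ≡ block v s n
block-cong s n agree =
  VP.tabulate-cong (λ j → agree _ (ℤP.i≤i+j s (+ toℕ j)) (ℤP.+-monoʳ-< s (+<+ (FP.toℕ<n j))))

interval-offset : s ℤ.≤ k → k ℤ.< s ℤ.+ + n → ∃ λ d → d < n × k ≡ s ℤ.+ + d
interval-offset {s} {k} {n} s≤k k<s+n = ∣ k ℤ.- s ∣ , d<n , k≡s+d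
  where
  s+[k-s] : ∀ k s → k ≡ s ℤ.+ (k ℤ.- s)
  s+[k-s] = ℤ-solve-∀

  k≡s+d : k ≡ s ℤ.+ + ∣ k ℤ.- s ∣
  k≡s+d = trans (s+[k-s] k s) (cong (ℤ._+_ s) (sym (ℤP.0≤i⇒+∣i∣≡i (ℤP.i≤j⇒0≤j-i s≤k))))

  d<n : ∣ k ℤ.- s ∣ < n
  d<n = ℕP.≰⇒> λ n≤d →
    ℤP.<⇒≱ k<s+n (ℤP.≤-trans (ℤP.+-monoʳ-≤ s (+≤+ n≤d)) (ℤP.≤-reflexive (sym k≡s+d)))

block-≡⇒pointwise : {u v : Word A} → block u s n ≡ block v s n →
                    ∀ k → s ℤ.≤ k → k ℤ.< s ℤ.+ + n → u k ≡ v k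
block-≡⇒pointwise {s = s} {u = u} {v} blocks≡ k s≤k k<s+n
  with d , d<n , refl ← interval-offset s≤k k<s+n = begin
  u (s ℤ.+ + d)                          ≡⟨ cong (λ j → u (s ℤ.+ + j)) (FP.toℕ-fromℕ< d<n) ⟨
  u (s ℤ.+ + toℕ (fromℕ< d<n))           ≡⟨ VP.lookup∘tabulate _ (fromℕ< d<n) ⟨
  lookup (block u s _) (fromℕ< d<n)      ≡⟨ cong (λ w → lookup w (fromℕ< d<n)) blocks≡ ⟩
  lookup (block v s _) (fromℕ< d<n)      ≡⟨ VP.lookup∘tabulate _ (fromℕ< d<n) ⟩
  v (s ℤ.+ + toℕ (fromℕ< d<n))           ≡⟨ cong (λ j → v (s ℤ.+ + j)) (FP.toℕ-fromℕ< d<n) ⟩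
  v (s ℤ.+ + d)                          ∎
  where open ≡-Reasoning

∈-─ : {x y : A} {xs : List A} (x∈xs : x ∈ xs) → y ∈ xs → y ≢ x → y ∈ (xs ─ x∈xs)
∈-─ (here refl)  (here refl)  y≢x = contradiction refl y≢x
∈-─ (here refl)  (there y∈xs) _   = y∈xs
∈-─ (there x∈xs) (here refl)  _   = here refl
∈-─ (there x∈xs) (there y∈xs) y≢x = there (∈-─ x∈xs y∈xs y≢x)

Unique-⊆⇒length-≤ : {xs ys : List A} → Unique xs → xs ⊆ ys → length xs ≤ length ys
Unique-⊆⇒length-≤ [] _ = z≤n
Unique-⊆⇒length-≤ {xs = x ∷ xs} {ys} (x∉xs ∷ unique) xs⊆ys = begin
  suc (length xs)           ≤⟨ s≤s (Unique-⊆⇒length-≤ unique xs⊆ys∖x) ⟩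
  suc (length (ys ─ x∈ys))  ≡⟨ length-removeAt′ ys (index x∈ys) ⟨
  length ys                 ∎
  where
  open ℕP.≤-Reasoning
  x∈ys : x ∈ ys
  x∈ys = xs⊆ys (here refl)
  xs⊆ys∖x : xs ⊆ (ys ─ x∈ys)
  xs⊆ys∖x y∈xs = ∈-─ x∈ys (xs⊆ys (there y∈xs)) (λ y≡x → All.lookup x∉xs y∈xs (sym y≡x))

Unique-covered⇒length-≤ : (h : A → B) {xs : List A} {ys : List B} → Unique ys →
                          (∀ {y} → y ∈ ys → ∃ λ x → x ∈ xs × h x ≡ y) → length ys ≤ length xs
Unique-covered⇒length-≤ h {xs} unique covered = ℕP.≤-trans
  (Unique-⊆⇒length-≤ unique λ y∈ys →
    let x , x∈xs , hx≡y = covered y∈ys in subst (_∈ map h xs) hx≡y (∈-map⁺ h x∈xs))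
  (ℕP.≤-reflexive (length-map h xs))

HasCard-onto⇒≤ : {P : A → Set} {Q : B → Set} (h : A → B) → HasCard P m → HasCard Q n →
                 (∀ y → Q y → ∃ λ x → P x × h x ≡ y) → n ≤ m
HasCard-onto⇒≤ h (xs , _ , refl , xs↔P) (ys , unique , refl , ys↔Q) onto =
  Unique-covered⇒length-≤ h unique λ {y} y∈ys →
    let x , Px , hx≡y = onto y (Equivalence.to (ys↔Q y) y∈ys) in
    x , Equivalence.from (xs↔P x) Px , hx≡y

-- With equally many elements, removing x₂ from the domain would leave too few to cover Q.
HasCard-onto⇒injective : {P : A → Set} {Q : B → Set} → DecidableEquality A → (h : A → B) →
                         HasCard P n → HasCard Q n → (∀ y → Q y → ∃ λ x → P x × h x ≡ y) →
                         ∀ {x₁ x₂} → P x₁ → P x₂ → h x₁ ≡ h x₂ → x₁ ≡ x₂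
HasCard-onto⇒injective _≟_ h (xs , _ , refl , xs↔P) (ys , unique , ys-length , ys↔Q) onto
                       {x₁} {x₂} Px₁ Px₂ hx₁≡hx₂ with x₁ ≟ x₂
... | yes x₁≡x₂ = x₁≡x₂
... | no x₁≢x₂ = contradiction too-few (ℕP.<-irrefl refl)
  where
  x₂∈xs : x₂ ∈ xs
  x₂∈xs = Equivalence.from (xs↔P x₂) Px₂

  covered : ∀ {y} → y ∈ ys → ∃ λ x → x ∈ (xs ─ x₂∈xs) × h x ≡ y
  covered {y} y∈ys with onto y (Equivalence.to (ys↔Q y) y∈ys)
  ... | x , Px , hx≡y with x ≟ x₂
  ...   | yes refl = x₁ , ∈-─ x₂∈xs (Equivalence.from (xs↔P x₁) Px₁) x₁≢x₂ , trans hx₁≡hx₂ hx≡y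
  ...   | no x≢x₂  = x , ∈-─ x₂∈xs (Equivalence.from (xs↔P x) Px) x≢x₂ , hx≡y

  too-few : length xs < length xs
  too-few = begin-strict
    length xs                 ≡⟨ ys-length ⟨
    length ys                 ≤⟨ Unique-covered⇒length-≤ h unique covered ⟩
    length (xs ─ x₂∈xs)       <⟨ ℕP.n<1+n _ ⟩
    suc (length (xs ─ x₂∈xs)) ≡⟨ length-removeAt′ xs (index x₂∈xs) ⟨
    length xs                 ∎
    where open ℕP.≤-Reasoning

HasCard-injective⇒left-inverse : {P : A → Set} → DecidableEquality B → (h : A → B) → (B → A) →
                                 HasCard P n → (∀ {x₁ x₂} → P x₁ → P x₂ → h x₁ ≡ h x₂ → x₁ ≡ x₂) →
                                 ∃ λ g → ∀ x → P x → g (h x) ≡ x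
HasCard-injective⇒left-inverse {A = A} {B = B} {P = P} _≟_ h default (xs , _ , _ , xs↔P) injective = g , g∘h
  where
  g : B → A
  g y with any? (λ x → h x ≟ y) xs
  ... | yes found = proj₁ (find found)
  ... | no _      = default y

  g∘h : ∀ x → P x → g (h x) ≡ x
  g∘h x Px with any? (λ x′ → h x′ ≟ h x) xs
  ... | yes found = let x′ , x′∈xs , hx′≡hx = find found in
                    injective (Equivalence.to (xs↔P x′) x′∈xs) Px hx′≡hx
  ... | no none   = contradiction (lose (Equivalence.from (xs↔P x) Px) refl) none

HasCard⇒decidable : {P : A → Set} → DecidableEquality A → HasCard P n → Decidable P
HasCard⇒decidable _≟_ (xs , _ , _ , xs↔P) x = Dec.map (xs↔P x) (DecMembership._∈?_ _≟_ x xs)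

-- Projections between block presentations

Recodes : (Vec A m → Vec B n) → Word A → Word B → Set
Recodes {m = m} {n = n} φ x y = ∀ i → φ (block x i m) ≡ block y i n

recode-forward : (Φ : (Z ^[ m ]) ≽ (W ^[ n ])) → ∀ {x} → Z x → ∃ λ y → W y × Recodes (proj₁ Φ) x y
recode-forward {m = m} (_ , into , _) {x} Zx = into (λ i → block x i m) (x , Zx , λ _ → refl)

recode-backward : (Φ : (Z ^[ m ]) ≽ (W ^[ n ])) → ∀ {y} → W y → ∃ λ x → Z x × Recodes (proj₁ Φ) x y
recode-backward {n = n} (φ , _ , onto) {y} Wy with onto (λ i → block y i n) (y , Wy , λ _ → refl)
... | _ , (x , Zx , u≡) , φu≡ = x , Zx , λ i → trans (cong φ (sym (u≡ i))) (φu≡ i)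

≽-from-recodes : (φ : Vec A m → Vec B n) →
                 (∀ x → Z x → ∃ λ y → W y × Recodes φ x y) →
                 (∀ y → W y → ∃ λ x → Z x × Recodes φ x y) → (Z ^[ m ]) ≽ (W ^[ n ])
≽-from-recodes {m = m} {n = n} {Z = Z} {W = W} φ forward backward = φ , into , onto
  where
  into : ∀ u → (Z ^[ m ]) u → (W ^[ n ]) (λ i → φ (u i))
  into u (x , Zx , u≡) =
    let y , Wy , recodes = forward x Zx in y , Wy , λ i → trans (cong φ (u≡ i)) (recodes i)
  onto : ∀ w → (W ^[ n ]) w → ∃ λ u → (Z ^[ m ]) u × (∀ i → φ (u i) ≡ w i)
  onto w (y , Wy , w≡) =
    let x , Zx , recodes = backward y Wy in
    (λ i → block x i m) , (x , Zx , λ _ → refl) , λ i → trans (recodes i) (sym (w≡ i))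

≽-map-recodes : (Φ : (Z ^[ m ]) ≽ (W ^[ n ])) (ψ : Vec A p → Vec B q) →
                (∀ {x y} → Z x → Recodes (proj₁ Φ) x y → Recodes ψ x y) → (Z ^[ p ]) ≽ (W ^[ q ])
≽-map-recodes Φ ψ transfer = ≽-from-recodes ψ
  (λ x Zx → let y , Wy , recodes = recode-forward Φ Zx in y , Wy , transfer {x} {y} Zx recodes)
  (λ y Wy → let x , Zx , recodes = recode-backward Φ Wy in x , Zx , transfer {x} {y} Zx recodes)

extend-code : (Vec A m → Vec B (suc n)) → Vec A (suc m) → Vec B (suc (suc n))
extend-code φ v = head (φ (init v)) ∷ φ (tail v)

Recodes-extend : (φ : Vec A m → Vec B (suc n)) (x : Word A) (y : Word B) →
                 Recodes φ x y → Recodes (extend-code φ) x y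
Recodes-extend {m = m} {n = n} φ x y recodes i = begin
  head (φ (init (block x i (suc m)))) ∷ φ (tail (block x i (suc m)))
    ≡⟨ cong₂ (λ v v′ → head (φ v) ∷ φ v′) (block-init x i m) (block-tail x i m) ⟩
  head (φ (block x i m)) ∷ φ (block x (sucℤ i) m)
    ≡⟨ cong₂ (λ v v′ → head v ∷ v′) (recodes i) (recodes (sucℤ i)) ⟩
  head (block y i (suc n)) ∷ block y (sucℤ i) (suc n)
    ≡⟨ cong (λ c → c ∷ block y (sucℤ i) (suc n)) (cong head (block-suc y i n)) ⟩
  y i ∷ block y (sucℤ i) (suc n)
    ≡⟨ block-suc y i (suc n) ⟨
  block y i (suc (suc n)) ∎
  where open ≡-Reasoning

≽-ascend : (Z ^[ m ]) ≽ (W ^[ suc n ]) → (Z ^[ suc m ]) ≽ (W ^[ suc (suc n) ])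
≽-ascend Φ@(φ , _) = ≽-map-recodes Φ (extend-code φ) λ {x} {y} _ → Recodes-extend φ x y

≽-descend : (Φ : (Z ^[ suc m ]) ≽ (W ^[ suc n ])) (ψ : Vec A m → Vec B n) →
            (∀ x → Z x → ∀ i → ψ (block x i m) ≡ init (proj₁ Φ (block x i (suc m)))) →
            (Z ^[ m ]) ≽ (W ^[ n ])
≽-descend {n = n} Φ ψ ψ≡init∘φ = ≽-map-recodes Φ ψ λ {x} {y} Zx recodes i →
  trans (ψ≡init∘φ x Zx i) (trans (cong init (recodes i)) (block-init y i n))

≽-truncate : (Z ^[ m ]) ≽ (W ^[ n + K ]) → (Z ^[ m ]) ≽ (W ^[ n ])
≽-truncate {n = n} {K = K} Φ = ≽-map-recodes Φ (λ v → take n (proj₁ Φ v)) λ {x} {y} _ recodes i →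
  trans (cong (take n) (recodes i)) (block-take y i n K)

≽-invert : (Ψ : (W ^[ q ]) ≽ (Z ^[ p ])) (g : Vec A p → Vec B q) →
           (∀ v → Lang W q v → g (proj₁ Ψ v) ≡ v) → (Z ^[ p ]) ≽ (W ^[ q ])
≽-invert {W = W} {q = q} Ψ g g∘ψ = ≽-from-recodes g
  (λ x Zx → let y , Wy , recodes = recode-backward Ψ Zx in y , Wy , inverse {x} {y} Wy recodes)
  (λ y Wy → let x , Zx , recodes = recode-forward Ψ Wy in x , Zx , inverse {x} {y} Wy recodes)
  where
  inverse : ∀ {x y} → W y → Recodes (proj₁ Ψ) y x → Recodes g x y
  inverse {x} {y} Wy recodes i =
    trans (cong g (sym (recodes i))) (g∘ψ (block y i q) (y , Wy , i , refl))

≽-Lang-onto : (Φ : (Z ^[ m ]) ≽ (W ^[ n ])) → ∀ w → Lang W n w → ∃ λ v → Lang Z m v × proj₁ Φ v ≡ w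
≽-Lang-onto {m = m} Φ w (y , Wy , i , y-block≡w) =
  let x , Zx , recodes = recode-backward Φ Wy in
  block x i m , (x , Zx , i , refl) , trans (recodes i) y-block≡w

≽-card-≤ : {kZ kW : ℕ} → HasCard (Lang Z m) kZ → HasCard (Lang W n) kW →
           (Z ^[ m ]) ≽ (W ^[ n ]) → kW ≤ kZ
≽-card-≤ HZ HW Φ = HasCard-onto⇒≤ (proj₁ Φ) HZ HW (≽-Lang-onto Φ)

similar-sym : Similar Z W → Similar W Z
similar-sym (Φ , Ψ) = Ψ , Φ

similar-ascend : (t : ℕ) → Similar (Z ^[ suc m ]) (W ^[ suc n ]) →
                 Similar (Z ^[ suc (t + m) ]) (W ^[ suc (t + n) ])
similar-ascend zero    similar = similar
similar-ascend (suc t) similar with Φ , Ψ ← similar-ascend t similar = ≽-ascend Φ , ≽-ascend Ψ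

-- The inverse of the bijection L_q(W) → L_p(Z) needs a fallback value off the language;
-- padding the block and applying the other projection supplies one even when B is empty.
similar-collapse : {Z : Subset A} {W : Subset B} → DecidableEquality A → DecidableEquality B →
                   HasCard (Lang Z (suc p)) n → HasCard (Lang W q) n →
                   Similar (Z ^[ suc p + K ]) (W ^[ q ]) → Similar (Z ^[ suc p ]) (W ^[ q ])
similar-collapse {A = A} {B = B} {p = p} {q = q} {K = K} {Z = Z} {W = W} _≟ᴬ_ _≟ᴮ_ HZ HW (Φ , Ψ) =
  ≽-invert Ψ′ (proj₁ left-inverse) (proj₂ left-inverse) , Ψ′
  where
  Ψ′ : (W ^[ q ]) ≽ (Z ^[ suc p ])
  Ψ′ = ≽-truncate Ψ
  fallback : Vec A (suc p) → Vec B q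
  fallback v = proj₁ Φ (v ++ replicate K (head v))
  left-inverse : ∃ λ g → ∀ v → Lang W q v → g (proj₁ Ψ′ v) ≡ v
  left-inverse = HasCard-injective⇒left-inverse (VP.≡-dec _≟ᴬ_) (proj₁ Ψ′) fallback HW
                   (HasCard-onto⇒injective (VP.≡-dec _≟ᴮ_) (proj₁ Ψ′) HW HZ (≽-Lang-onto Ψ′))

-- Subshifts of finite type

SFT-shift : {F : List (Vec (Fin a) (suc n))} (u : Word (Fin a)) (d : ℤ) →
            SFT n F u → SFT n F (λ k → u (k ℤ.+ d))
SFT-shift {n = n} {F} u d Xu t = subst (λ w → ¬ w ∈ F) (sym (block-shift u d t (suc n))) (Xu (t ℤ.+ d))

Lang-SFT-at : {F : List (Vec (Fin a) (suc n))} {w : Vec (Fin a) m} →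
              Lang (SFT n F) m w → ∀ e → ∃ λ u → SFT n F u × block u e m ≡ w
Lang-SFT-at {m = m} (u , Xu , j , u-block≡w) e =
  (λ k → u (k ℤ.+ (j ℤ.- e))) , SFT-shift u (j ℤ.- e) Xu ,
  trans (block-shift u (j ℤ.- e) e m) (trans (cong (λ i → block u i m) (e+[j-e] e j)) u-block≡w)
  where
  e+[j-e] : ∀ e j → e ℤ.+ (j ℤ.- e) ≡ j
  e+[j-e] = ℤ-solve-∀

splice : ℤ → Word A → Word A → Word A
splice e u v k = if does (k ℤ.≤? e) then u k else v k

splice-≤ : (u v : Word A) → k ℤ.≤ e → splice e u v k ≡ u k
splice-≤ {k = k} {e} u v k≤e with k ℤ.≤? e
... | yes _  = refl
... | no k≰e = contradiction k≤e k≰e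

splice-> : (u v : Word A) → e ℤ.< k → splice e u v k ≡ v k
splice-> {e = e} {k} u v e<k with k ℤ.≤? e
... | yes k≤e = contradiction k≤e (ℤP.<⇒≱ e<k)
... | no _    = refl

splice-block-after : (u v : Word A) (n : ℕ) → e ℤ.< t → block (splice e u v) t n ≡ block v t n
splice-block-after {t = t} u v n e<t = block-cong t n λ k t≤k _ → splice-> u v (ℤP.<-≤-trans e<t t≤k)

splice-block-at : (u v : Word A) (e : ℤ) (n : ℕ) →
                  block (splice e u v) e (suc n) ≡ u e ∷ block v (sucℤ e) n
splice-block-at u v e n = trans (block-suc (splice e u v) e n)
  (cong₂ _∷_ (splice-≤ u v (ℤP.≤-refl {e})) (splice-block-after u v n (i<suc[i] e)))

-- Every window other than the one at e lies where the spliced point agrees with u or with v.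
SFT-splice : {F : List (Vec (Fin a) (suc (suc n)))} (u v : Word (Fin a)) (e : ℤ) →
             SFT (suc n) F u → SFT (suc n) F v →
             block u (sucℤ e) n ≡ block v (sucℤ e) n → ¬ (u e ∷ block v (sucℤ e) (suc n) ∈ F) →
             SFT (suc n) F (splice e u v)
SFT-splice {n = n} {F} u v e Xu Xv shared straddling t with ℤP.<-cmp t e
... | tri< t<e _ _ = subst (λ w → ¬ w ∈ F) (sym (block-cong t (suc (suc n)) λ k _ k<t+n+2 →
                       splice-agrees-u k (ℤP.<-≤-trans k<t+n+2 (window-end t<e)))) (Xu t)
  where
  window-end : t ℤ.< e → t ℤ.+ + suc (suc n) ℤ.≤ sucℤ e ℤ.+ + n
  window-end t<e = subst₂ ℤ._≤_ (sym (+-suc-index t (suc n))) (+-suc-index e n)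
                     (ℤP.+-monoˡ-≤ (+ suc n) (ℤP.i<j⇒suc[i]≤j t<e))
  splice-agrees-u : ∀ k → k ℤ.< sucℤ e ℤ.+ + n → splice e u v k ≡ u k
  splice-agrees-u k k<e+1+n with k ℤ.≤? e
  ... | yes _  = refl
  ... | no k≰e = sym (block-≡⇒pointwise shared k (ℤP.i<j⇒suc[i]≤j (ℤP.≰⇒> k≰e)) k<e+1+n)
... | tri≈ _ refl _ = subst (λ w → ¬ w ∈ F) (sym (splice-block-at u v e (suc n))) straddling
... | tri> _ _ e<t  = subst (λ w → ¬ w ∈ F) (sym (splice-block-after u v (suc (suc n)) e<t)) (Xv t)

module SFTDescent {a L : ℕ} {F : List (Vec (Fin a) (suc (suc L)))}
                  (lang? : Decidable (Lang (SFT (suc L) F) (suc L))) where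

  private
    X : Subset (Fin a)
    X = SFT (suc L) F

  CanPrecede : Fin a → Vec (Fin a) (suc L) → Set
  CanPrecede c w = Lang X (suc L) (c ∷ init w) × ¬ (c ∷ w ∈ F)

  canPrecede? : ∀ c w → Dec (CanPrecede c w)
  canPrecede? c w = lang? (c ∷ init w) ×-dec ¬? (DecMembership._∈?_ (VP.≡-dec FP._≟_) (c ∷ w) F)

  -- On blocks of X some letter can always precede, so the fallback head is never used there.
  predecessor : Vec (Fin a) (suc L) → Fin a
  predecessor w with FP.any? (λ c → canPrecede? c w)
  ... | yes (c , _) = c
  ... | no _        = head w

  predecessor-canPrecede : ∀ c w → CanPrecede c w → CanPrecede (predecessor w) w
  predecessor-canPrecede c w c-precedes with FP.any? (λ c → canPrecede? c w)
  ... | yes (_ , precedes) = precedes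
  ... | no none            = contradiction (c , c-precedes) none

  canPrecede-block : ∀ u → X u → ∀ e → CanPrecede (u e) (block u (sucℤ e) (suc L))
  canPrecede-block u Xu e =
    (u , Xu , e , trans (block-suc u e L) (cong (u e ∷_) (sym (block-init u (sucℤ e) L)))) ,
    subst (λ w → ¬ w ∈ F) (block-suc u e (suc L)) (Xu e)

  canPrecede-splice : ∀ c v e → X v → CanPrecede c (block v (sucℤ e) (suc L)) →
                      ∃ λ u → X (splice e u v) × u e ≡ c
  canPrecede-splice c v e Xv (c∷w∈Lang , c∷w∉F) with Lang-SFT-at c∷w∈Lang e
  ... | u , Xu , u-block≡ =
    u , SFT-splice u v e Xu Xv shared (subst (λ c′ → ¬ c′ ∷ _ ∈ F) (sym ue≡c) c∷w∉F) , ue≡c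
    where
    ue≡c : u e ≡ c
    ue≡c = cong head (trans (sym (block-suc u e L)) u-block≡)
    shared : block u (sucℤ e) L ≡ block v (sucℤ e) L
    shared = begin
      block u (sucℤ e) L               ≡⟨ block-tail u e L ⟨
      tail (block u e (suc L))         ≡⟨ cong tail u-block≡ ⟩
      init (block v (sucℤ e) (suc L))  ≡⟨ block-init v (sucℤ e) L ⟩
      block v (sucℤ e) L               ∎
      where open ≡-Reasoning

  ≽-descend-SFT : {W : Subset B} → (X ^[ suc (suc L + K) ]) ≽ (W ^[ suc n ]) →
                  (X ^[ suc L + K ]) ≽ (W ^[ n ])
  ≽-descend-SFT {B = B} {K = K} {n = n} Φ@(φ , _) = ≽-descend Φ ψ λ v Xv i →
    subst (λ j → ψ (block v j M) ≡ init (φ (block v j (suc M)))) (ℤP.suc-pred i) (ψ-after v Xv (predℤ i))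
    where
    M : ℕ
    M = suc L + K
    ψ : Vec (Fin a) M → Vec B n
    ψ w = tail (φ (predecessor (take (suc L) w) ∷ w))

    ψ-spliced : ∀ v e u y → u e ≡ predecessor (block v (sucℤ e) (suc L)) → Recodes φ (splice e u v) y →
                ψ (block v (sucℤ e) M) ≡ init (φ (block v (sucℤ e) (suc M)))
    ψ-spliced v e u y ue≡c recodes = begin
      tail (φ (predecessor (take (suc L) (block v (sucℤ e) M)) ∷ block v (sucℤ e) M))
        ≡⟨ cong (λ w′ → tail (φ (predecessor w′ ∷ block v (sucℤ e) M))) (block-take v (sucℤ e) (suc L) K) ⟩
      tail (φ (predecessor (block v (sucℤ e) (suc L)) ∷ block v (sucℤ e) M))
        ≡⟨ cong (λ c → tail (φ (c ∷ block v (sucℤ e) M))) ue≡c ⟨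
      tail (φ (u e ∷ block v (sucℤ e) M))
        ≡⟨ cong (λ w′ → tail (φ w′)) (splice-block-at u v e M) ⟨
      tail (φ (block (splice e u v) e (suc M)))
        ≡⟨ cong tail (recodes e) ⟩
      tail (block y e (suc n))
        ≡⟨ block-tail y e n ⟩
      block y (sucℤ e) n
        ≡⟨ block-init y (sucℤ e) n ⟨
      init (block y (sucℤ e) (suc n))
        ≡⟨ cong init (recodes (sucℤ e)) ⟨
      init (φ (block (splice e u v) (sucℤ e) (suc M)))
        ≡⟨ cong (λ w′ → init (φ w′)) (splice-block-after u v (suc M) (i<suc[i] e)) ⟩
      init (φ (block v (sucℤ e) (suc M)))  ∎
      where open ≡-Reasoning

    ψ-after : ∀ v → X v → ∀ e → ψ (block v (sucℤ e) M) ≡ init (φ (block v (sucℤ e) (suc M)))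
    ψ-after v Xv e =
      let w = block v (sucℤ e) (suc L)
          u , Xr , ue≡c = canPrecede-splice (predecessor w) v e Xv
                            (predecessor-canPrecede (v e) w (canPrecede-block v Xv e))
          y , _ , recodes = recode-forward Φ {splice e u v} Xr
      in ψ-spliced v e u y ue≡c recodes

-- Classification of direct conjugacies between two SFTs

module Classification {a b LX LY kX kY : ℕ}
                      {FX : List (Vec (Fin a) (suc (suc LX)))} {FY : List (Vec (Fin b) (suc (suc LY)))}
                      (HX : HasCard (Lang (SFT (suc LX) FX) (suc LX)) kX)
                      (HY : HasCard (Lang (SFT (suc LY) FY) (suc LY)) kY) where

  private
    lx ly : ℕ
    lx = suc LX
    ly = suc LY
    X : Subset (Fin a)
    X = SFT lx FX
    Y : Subset (Fin b)
    Y = SFT ly FY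
    module DX = SFTDescent (HasCard⇒decidable (VP.≡-dec FP._≟_) HX)
    module DY = SFTDescent (HasCard⇒decidable (VP.≡-dec FP._≟_) HY)

  Sim : ℕ → ℕ → Set
  Sim m n = Similar (X ^[ m ]) (Y ^[ n ])

  NormalForm : Set
  NormalForm = (∃ λ K → Sim (lx + suc K) ly) ⊎ Sim lx ly ⊎ (∃ λ K → Sim lx (ly + suc K))

  normal-form-descend : ∀ i j → Sim (lx + i) (ly + j) → NormalForm
  normal-form-descend zero    zero    s = inj₂ (inj₁ (subst₂ Sim (ℕP.+-identityʳ lx) (ℕP.+-identityʳ ly) s))
  normal-form-descend zero    (suc j) s =
    inj₂ (inj₂ (j , subst (λ m → Sim m (ly + suc j)) (ℕP.+-identityʳ lx) s))
  normal-form-descend (suc i) zero    s = inj₁ (i , subst (Sim (lx + suc i)) (ℕP.+-identityʳ ly) s)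
  normal-form-descend (suc i) (suc j) s with Φ , Ψ ← subst₂ Sim (ℕP.+-suc lx i) (ℕP.+-suc ly j) s =
    normal-form-descend i j (DX.≽-descend-SFT Φ , DY.≽-descend-SFT Ψ)

  -- Lifting by lx + ly first makes both block lengths exceed lx and ly.
  conjugate⇒normal-form : DirectlyConjugate X Y → NormalForm
  conjugate⇒normal-form (M , N , s) = normal-form-descend (ly + suc M) (lx + suc N)
    (subst₂ Sim (reassoc lx ly M) (trans (cong (λ t → suc (t + N)) (ℕP.+-comm lx ly)) (reassoc ly lx N))
      (similar-ascend (lx + ly) s))
    where
    reassoc : ∀ p q M → suc ((p + q) + M) ≡ p + (q + suc M)
    reassoc = ℕ-solve-∀

  smaller-language⇒longer-blocks : kX < kY → DirectlyConjugate X Y → ∃ λ K → Sim (lx + suc K) ly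
  smaller-language⇒longer-blocks kX<kY conjugate = from-normal-form (conjugate⇒normal-form conjugate)
    where
    from-normal-form : NormalForm → ∃ λ K → Sim (lx + suc K) ly
    from-normal-form (inj₁ longer)         = longer
    from-normal-form (inj₂ (inj₁ s))       = contradiction (≽-card-≤ HX HY (proj₁ s)) (ℕP.<⇒≱ kX<kY)
    from-normal-form (inj₂ (inj₂ (_ , s))) =
      contradiction (≽-card-≤ HX HY (≽-truncate (proj₁ s))) (ℕP.<⇒≱ kX<kY)

  equal-language⇒minimal-blocks : kX ≡ kY → DirectlyConjugate X Y → Sim lx ly
  equal-language⇒minimal-blocks kX≡kY conjugate = from-normal-form (conjugate⇒normal-form conjugate)
    where
    from-normal-form : NormalForm → Sim lx ly
    from-normal-form (inj₁ (_ , s))        =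
      similar-collapse FP._≟_ FP._≟_ HX (subst (HasCard _) (sym kX≡kY) HY) s
    from-normal-form (inj₂ (inj₁ s))       = s
    from-normal-form (inj₂ (inj₂ (_ , s))) =
      similar-sym (similar-collapse FP._≟_ FP._≟_ HY (subst (HasCard _) kX≡kY HX) (similar-sym s))

conjugate-sym : DirectlyConjugate Z W → DirectlyConjugate W Z
conjugate-sym (M , N , s) = N , M , similar-sym s

proposition6 : (a b : ℕ) (LX LY : ℕ)
    → (FX : List (Vec (Fin a) (suc (suc LX))))
    → (FY : List (Vec (Fin b) (suc (suc LY))))
    → (kX kY : ℕ)
    → HasCard (Lang (SFT (suc LX) FX) (suc LX)) kX
    → HasCard (Lang (SFT (suc LY) FY) (suc LY)) kY
    → (kX < kY → (DirectlyConjugate (SFT (suc LX) FX) (SFT (suc LY) FY)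
          ⇔ ∃ λ K → Similar (SFT (suc LX) FX ^[ suc LX + suc K ]) (SFT (suc LY) FY ^[ suc LY ])))
    × (kX > kY → (DirectlyConjugate (SFT (suc LX) FX) (SFT (suc LY) FY)
          ⇔ ∃ λ K → Similar (SFT (suc LX) FX ^[ suc LX ]) (SFT (suc LY) FY ^[ suc LY + suc K ])))
    × (kX ≡ kY → (DirectlyConjugate (SFT (suc LX) FX) (SFT (suc LY) FY)
          ⇔ Similar (SFT (suc LX) FX ^[ suc LX ]) (SFT (suc LY) FY ^[ suc LY ])))
proposition6 a b LX LY FX FY kX kY HX HY =
  (λ kX<kY → mk⇔ (XY.smaller-language⇒longer-blocks kX<kY) λ (K , s) → LX + suc K , LY , s) ,
  (λ kX>kY → mk⇔ (map₂ similar-sym ∘ YX.smaller-language⇒longer-blocks kX>kY ∘ conjugate-sym)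
                  λ (K , s) → LX , LY + suc K , s) ,
  (λ kX≡kY → mk⇔ (XY.equal-language⇒minimal-blocks kX≡kY) λ s → LX , LY , s)
  where
  module XY = Classification HX HY
  module YX = Classification HY HX
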